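{- Let $g,d$ be positive integers and let $\preceq$ be an $\mathcal{O}$-good relaxed monomial order on $\mathbb{N}^d$ (for these $g,d$). Let $\mathcal{K}^{\operatorname{R}}_{g,d,\preceq}$ be the oriented graph with vertex set $\operatorname{R}_\preceq(\mathcal{S}_{g,d})$ in which $(S,T)$ is an edge if and only if $S\neq O_{g,d}(\preceq)$ and $T=(S\cup\{\mathbf{F}_\preceq(S)\})\setminus\{\mathbf{m}_\preceq(S)\}$. Then $\mathcal{K}^{\operatorname{R}}_{g,d,\preceq}$ is a rooted tree with root $O_{g,d}(\preceq)$. Moreover, if $T\in\operatorname{R}_\preceq(\mathcal{S}_{g,d})$, then the children of $T$ are the semigroups of the form $T_{\mathbf{h},\mathbf{x}}=(T\cup\{\mathbf{h}\})\setminus\{\mathbf{x}\}$ with $\mathbf{h}\in\operatorname{SG}(T)$, $\mathbf{h}\prec\mathbf{m}_\preceq(T)$, and $\mathbf{x}\in\mathbf{U}_\preceq(T\cup\{\mathbf{h}\})\setminus\{\mathbf{h}\}$, such that $T_{\mathbf{h},\mathbf{x}}\in\operatorname{R}_\preceq(\mathcal{S}_{g,d})$.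
   Context: A generalized numerical semigroup (GNS) in $\mathbb{N}^d$ is a submonoid $S$ of $(\mathbb{N}^d,+)$ with $\operatorname{H}(S)=\mathbb{N}^d\setminus S$ finite; $|\operatorname{H}(S)|$ is its genus; $\mathcal{S}_{g,d}$ is the set of GNSs in $\mathbb{N}^d$ of genus $g$. $\operatorname{A}(S)=S^*\setminus(S^*+S^*)$, $S^*=S\setminus\{\mathbf{0}\}$, is the minimal generating set. $\operatorname{PF}(S)=\{\mathbf{h}\in\operatorname{H}(S)\mid\mathbf{h}+\mathbf{s}\in S\ \forall\mathbf{s}\in S^*\}$ and $\operatorname{SG}(S)=\{\mathbf{h}\in\operatorname{PF}(S)\mid 2\mathbf{h}\in S\}$. $\operatorname{P}_d$ is the set of permutations of $\{1,\ldots,d\}$, acting by $\sigma(\sum x_i\mathbf{e}_i)=\sum x_i\mathbf{e}_{\sigma(i)}$ ($\mathbf{e}_i$ the standard basis), and $[S]_\simeq=\{\sigma(S)\mid\sigma\in\operatorname{P}_d\}$. A relaxed monomial order is a total order $\preceq$ on $\mathbb{N}^d$ with $\mathbf{0}\preceq\mathbf{v}$ for all $\mathbf{v}$ and such that $\mathbf{v}\prec\mathbf{w}$ implies $\mathbf{v}\prec\mathbf{w}+\mathbf{u}$ for all $\mathbf{u}$. $\mathbf{F}_\preceq(S)=\max_\preceq\operatorname{H}(S)$, $\mathbf{m}_\preceq(S)=\min_\preceq S^*$, $\mathbf{U}_\preceq(S)=\{\mathbf{x}\in\operatorname{A}(S)\mid\mathbf{F}_\preceq(S)\prec\mathbf{x}\}$.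 For $S,S'\in\mathcal{S}_{g,d}$ with gaps $\mathbf{h}_1\prec\cdots\prec\mathbf{h}_g$ and $\mathbf{h}'_1\prec\cdots\prec\mathbf{h}'_g$, $S\preceq_{\operatorname{R}}S'$ means $S=S'$ or $\mathbf{h}_r\prec\mathbf{h}'_r$ for $r=\min\{i\mid\mathbf{h}_i\neq\mathbf{h}'_i\}$; $\operatorname{R}_\preceq(S)=\min_{\preceq_{\operatorname{R}}}[S]_\simeq$ and $\operatorname{R}_\preceq(\mathcal{S}_{g,d})=\{\operatorname{R}_\preceq(S)\mid S\in\mathcal{S}_{g,d}\}$. If $\mathbf{0}=\mathbf{s}_0\prec\mathbf{s}_1\prec\cdots\prec\mathbf{s}_g$ are the $g+1$ smallest elements of $\mathbb{N}^d$ w.r.t. $\preceq$, then $O_{g,d}(\preceq)=\{\mathbf{x}\in\mathbb{N}^d\mid\mathbf{s}_g\prec\mathbf{x}\}\cup\{\mathbf{0}\}$ (a GNS of genus $g$, belonging to $\operatorname{R}_\preceq(\mathcal{S}_{g,d})$). The order $\preceq$ is $\mathcal{O}$-good (for $g,d$) if $(S\cup\{\mathbf{F}_\preceq(S)\})\setminus\{\mathbf{m}_\preceq(S)\}\in\operatorname{R}_\preceq(\mathcal{S}_{g,d})$ for all $S\in\operatorname{R}_\preceq(\mathcal{S}_{g,d})$. A rooted tree with root $\mathbf{v}$ is an oriented graph in which every vertex has a unique path (distinct vertices joined by directed edges) to $\mathbf{v}$; if $(\mathbf{x},\mathbf{y})$ is an edge, $\mathbf{x}$ is a child of $\mathbf{y}$.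 -}

module Defs where

open import Level using (0ℓ)
open import Data.Nat as ℕ using (ℕ; zero; suc)
open import Data.Fin as F using (Fin; fromℕ; fromℕ<; inject₁)
open import Data.Fin.Permutation using (Permutation′; _⟨$⟩ʳ_; _⟨$⟩ˡ_)
open import Data.Vec using (Vec; replicate; zipWith; tabulate; lookup)
open import Data.List using (List; length)
open import Data.List.Membership.Propositional using (_∈_)
open import Data.List.Relation.Unary.Unique.Propositional using (Unique)
open import Data.Product using (Σ; ∃; ∃-syntax; _×_; _,_)
open import Data.Sum using (_⊎_)
open import Relation.Nullary using (¬_)
open import Relation.Unary using (Pred; _≐_)
open import Relation.Binary.PropositionalEquality using (_≡_; _≢_)
open import Relation.Binary.Structures using (IsTotalOrder)

Pt : ℕ → Set
Pt d = Vec ℕ d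

𝟎 : ∀ {d} → Pt d
𝟎 = replicate _ 0

infixl 6 _⊕_
_⊕_ : ∀ {d} → Pt d → Pt d → Pt d
_⊕_ = zipWith ℕ._+_

-- Subsets of ℕ^d are predicates; equality of subsets is extensional (_≐_).
PSet : ℕ → Set₁
PSet d = Pred (Pt d) 0ℓ

record IsGNS (g : ℕ) {d : ℕ} (S : PSet d) : Set where
  field
    zero∈   : S 𝟎
    closed  : ∀ x y → S x → S y → S (x ⊕ y)
    gaps      : List (Pt d)
    gapsUniq  : Unique gaps
    gapsLen   : length gaps ≡ g
    gapsCover : ∀ x → S x ⊎ x ∈ gaps
    gapsGap   : ∀ x → x ∈ gaps → ¬ S x

S* : ∀ {d} → PSet d → PSet d
S* S x = S x × x ≢ 𝟎

Atoms : ∀ {d} → PSet d → PSet d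
Atoms S x = S* S x × ¬ (∃[ y ] ∃[ z ] (S* S y × S* S z × x ≡ y ⊕ z))

PF : ∀ {d} → PSet d → PSet d
PF S h = ¬ S h × (∀ s → S* S s → S (h ⊕ s))

SG : ∀ {d} → PSet d → PSet d
SG S h = PF S h × S (h ⊕ h)

_∪｛_｝ : ∀ {d} → PSet d → Pt d → PSet d
(S ∪｛ h ｝) y = S y ⊎ y ≡ h

_∖｛_｝ : ∀ {d} → PSet d → Pt d → PSet d
(S ∖｛ x ｝) y = S y × y ≢ x

-- Permutations acting on ℕ^d :  σ(Σ xᵢ eᵢ) = Σ xᵢ e_{σ(i)},
-- i.e. (σ x)_j = x_{σ⁻¹(j)}

act : ∀ {d} → Permutation′ d → Pt d → Pt d
act σ x = tabulate (λ j → lookup x (σ ⟨$⟩ˡ j))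

actSet : ∀ {d} → Permutation′ d → PSet d → PSet d
actSet σ S y = ∃[ x ] (S x × y ≡ act σ x)

module Order {d : ℕ} (_≼_ : Pt d → Pt d → Set) where

  infix 4 _≺_
  _≺_ : Pt d → Pt d → Set
  v ≺ w = v ≼ w × v ≢ w

  record IsRelaxedMonomialOrder : Set where
    field
      isTotalOrder : IsTotalOrder _≡_ _≼_
      zero-least   : ∀ v → 𝟎 ≼ v
      compat       : ∀ v w u → v ≺ w → v ≺ (w ⊕ u)

  IsFrob : PSet d → Pt d → Set
  IsFrob S f = ¬ S f × (∀ h → ¬ S h → h ≼ f)

  IsMult : PSet d → Pt d → Set
  IsMult S m = S* S m × (∀ s → S* S s → m ≼ s)

  -- U_≼(S) = { x ∈ A(S) | F_≼(S) ≺ x }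
  -- (when S has no gaps the condition on F is vacuous, so U = A)
  U : PSet d → PSet d
  U S x = Atoms S x × (∀ f → IsFrob S f → f ≺ x)

  Step : PSet d → Pt d → Pt d → PSet d
  Step S f m = (S ∪｛ f ｝) ∖｛ m ｝

  module _ (g : ℕ) where

    GapSeq : PSet d → (Fin g → Pt d) → Set
    GapSeq S hs = (∀ i j → i F.< j → hs i ≺ hs j)
                × (∀ x → (¬ S x → ∃[ i ] hs i ≡ x) × (∃[ i ] hs i ≡ x → ¬ S x))

    _≼R_ : PSet d → PSet d → Set
    S ≼R S' = S ≐ S'
            ⊎ (∀ hs hs' → GapSeq S hs → GapSeq S' hs' →
                 ∃[ r ] ((∀ i → i F.< r → hs i ≡ hs' i) × hs r ≺ hs' r))

    InR : PSet d → Set₁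
    InR S = Σ (PSet d) λ S' → IsGNS g S'
          × (∃[ σ ] (S ≐ actSet σ S'))
          × (∀ τ → S ≼R actSet τ S')

    GSmallest : (Fin (suc g) → Pt d) → Set
    GSmallest s = (∀ i j → i F.< j → s i ≺ s j)
                × (∀ y → (∀ i → y ≢ s i) → s (fromℕ g) ≺ y)

    Oset : (Fin (suc g) → Pt d) → PSet d
    Oset s x = s (fromℕ g) ≺ x ⊎ x ≡ 𝟎

    OGood : Set₁
    OGood = ∀ S → InR S → ∀ f m → IsFrob S f → IsMult S m → InR (Step S f m)

    Edge : PSet d → PSet d → PSet d → Set₁
    Edge O S T = InR S × InR T × ¬ (S ≐ O)
               × ∃[ f ] ∃[ m ] (IsFrob S f × IsMult S m × T ≐ Step S f m)

module Graph {d : ℕ} (V : PSet d → Set₁) (E : PSet d → PSet d → Set₁) where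

  record Path (S T : PSet d) : Set₁ where
    field
      len     : ℕ
      vtx     : Fin (suc len) → PSet d
      isVtx   : ∀ i → V (vtx i)
      start   : vtx F.zero ≐ S
      end     : vtx (fromℕ len) ≐ T
      edges   : ∀ (i : Fin len) → E (vtx (inject₁ i)) (vtx (F.suc i))
      distinct : ∀ i j → vtx i ≐ vtx j → i ≡ j

  open Path

  SamePath : ∀ {S T} → Path S T → Path S T → Set
  SamePath p q = len p ≡ len q
               × (∀ i (ip : i ℕ.< suc (len p)) (iq : i ℕ.< suc (len q)) →
                    vtx p (fromℕ< ip) ≐ vtx q (fromℕ< iq))

  RootedTree : PSet d → Set₁
  RootedTree r = V r × (∀ S → V S → Path S r × (∀ (p q : Path S r) → SamePath p q))

{-# OPTIONS --safe #-}

-- Write 𝟎 = s₀ ≺ s₁ ≺ ⋯ ≺ s_g for the g + 1 smallest points, so that the gaps of O are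
-- exactly s₁, …, s_g.  If S ∈ R(𝒮_{g,d}) is not O, some sᵢ lies in S; as S has only g
-- gaps, F(S) ≻ s_g and the least such sᵢ is m(S).  Hence the step
-- S ↦ (S ∪ {F(S)}) ∖ {m(S)}, which stays in R by 𝒪-goodness, removes one sᵢ from S, and
-- iterating it reaches O, the only vertex without an outgoing edge.  Since F(S) and m(S)
-- are unique, every vertex has at most one outgoing edge, so the path to O is unique.
-- Conversely, if T is the step of S then S = (T ∪ {h}) ∖ {x} with h = m(S) and x = F(S),
-- which satisfy h ∈ SG(T), h ≺ m(T) and x ∈ U(T ∪ {h}); and these conditions make h and x
-- the multiplicity and the Frobenius element of (T ∪ {h}) ∖ {x}.

module Submission where

open import Defs
open import Level using (0ℓ)
open import Data.Nat as ℕ using (ℕ; zero; suc; _≤_; _<_; s≤s; z≤n)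
import Data.Nat.Properties as ℕP
open import Data.Fin as F using (Fin; fromℕ; fromℕ<; inject₁)
import Data.Fin.Properties as FP
open import Data.Fin.Permutation as Perm using (Permutation′; _⟨$⟩ˡ_; inverseʳ)
open import Data.Vec as V using (Vec; []; _∷_; lookup; count)
import Data.Vec.Properties as VP
open import Data.Vec.Relation.Unary.Any using (Any; here; there)
open import Data.Vec.Relation.Unary.All using (All; []; _∷_)
import Data.Vec.Relation.Unary.All.Properties as VAllP
import Data.Vec.Relation.Unary.Any.Properties as VAnyP
open import Data.List as L using (List; length)
import Data.List.Properties as LP
open import Data.List.Membership.Propositional using (_∈_)
import Data.List.Membership.Propositional.Properties as L∈
import Data.List.Relation.Unary.All as LAll
import Data.List.Relation.Unary.All.Properties as LAllP
open import Data.List.Relation.Unary.AllPairs using (_∷_)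
import Data.List.Relation.Unary.Any as LAny
import Data.List.Relation.Unary.Any.Properties as LAnyP
open import Data.List.Relation.Unary.Unique.Propositional using (Unique)
import Data.List.Relation.Unary.Unique.Propositional.Properties as UniqueP
import Data.List.Extrema as Extrema
open import Data.Product using (∃; ∃-syntax; _×_; _,_; proj₁; proj₂)
open import Data.Sum using (_⊎_; inj₁; inj₂)
open import Data.Empty using (⊥-elim)
open import Function using (_∘_; id)
open import Function.Definitions using (Injective)
open import Relation.Nullary using (¬_; Dec; yes; no; contradiction; ¬?)
open import Relation.Nullary.Decidable using (map′; decidable-stable; _⊎-dec_)
open import Relation.Unary using (Pred; Decidable; _≐_)
open import Relation.Unary.Properties using (≐-refl; ≐-sym; ≐-trans)
open import Relation.Binary.Bundles using (TotalOrder; DecTotalOrder)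
open import Relation.Binary.Structures using (IsTotalOrder)
open import Relation.Binary.Definitions using (tri<; tri≈; tri>)
import Relation.Binary.Properties.TotalOrder as TotalOrderProperties
import Relation.Binary.Properties.DecTotalOrder as DecTotalOrderProperties
import Relation.Binary.Construct.NonStrictToStrict as ToStrict
import Relation.Binary.Reasoning.PartialOrder as PartialOrderReasoning
open import Relation.Binary.PropositionalEquality

_≟ᴾ_ : ∀ {d} (x y : Pt d) → Dec (x ≡ y)
_≟ᴾ_ = VP.≡-dec ℕP._≟_

⊕-comm : ∀ {d} (x y : Pt d) → x ⊕ y ≡ y ⊕ x
⊕-comm = VP.zipWith-comm ℕP.+-comm

⊕-identityˡ : ∀ {d} (x : Pt d) → 𝟎 ⊕ x ≡ x
⊕-identityˡ = VP.zipWith-identityˡ ℕP.+-identityˡ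

⊕-identityʳ : ∀ {d} (x : Pt d) → x ⊕ 𝟎 ≡ x
⊕-identityʳ = VP.zipWith-identityʳ ℕP.+-identityʳ

x⊕y≡x⇒y≡𝟎 : ∀ {d} {x y : Pt d} → x ⊕ y ≡ x → y ≡ 𝟎
x⊕y≡x⇒y≡𝟎 {x = []}    {[]}    _ = refl
x⊕y≡x⇒y≡𝟎 {x = a ∷ x} {b ∷ y} e =
  cong₂ _∷_ (ℕP.+-cancelˡ-≡ a _ 0 (trans (VP.∷-injectiveˡ e) (sym (ℕP.+-identityʳ a))))
            (x⊕y≡x⇒y≡𝟎 (VP.∷-injectiveʳ e))

lookup-≗⇒≡ : ∀ {A : Set} {n} {u v : Vec A n} → (∀ i → lookup u i ≡ lookup v i) → u ≡ v
lookup-≗⇒≡ {u = u} {v} u≗v =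
  trans (sym (VP.tabulate∘lookup u)) (trans (VP.tabulate-cong u≗v) (VP.tabulate∘lookup v))

lookup-act : ∀ {d} (σ : Permutation′ d) x j → lookup (act σ x) j ≡ lookup x (σ ⟨$⟩ˡ j)
lookup-act σ x = VP.lookup∘tabulate _

module _ {d : ℕ} (σ : Permutation′ d) where

  act-⊕ : ∀ x y → act σ (x ⊕ y) ≡ act σ x ⊕ act σ y
  act-⊕ x y = lookup-≗⇒≡ λ j → begin
    lookup (act σ (x ⊕ y)) j                     ≡⟨ lookup-act σ (x ⊕ y) j ⟩
    lookup (x ⊕ y) (σ ⟨$⟩ˡ j)                    ≡⟨ VP.lookup-zipWith ℕ._+_ (σ ⟨$⟩ˡ j) x y ⟩
    lookup x (σ ⟨$⟩ˡ j) ℕ.+ lookup y (σ ⟨$⟩ˡ j)  ≡⟨ cong₂ ℕ._+_ (lookup-act σ x j) (lookup-act σ y j) ⟨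
    lookup (act σ x) j ℕ.+ lookup (act σ y) j    ≡⟨ VP.lookup-zipWith ℕ._+_ j (act σ x) (act σ y) ⟨
    lookup (act σ x ⊕ act σ y) j                 ∎
    where open ≡-Reasoning

  act-𝟎 : act σ 𝟎 ≡ 𝟎
  act-𝟎 = lookup-≗⇒≡ λ j →
    trans (lookup-act σ 𝟎 j) (trans (VP.lookup-replicate (σ ⟨$⟩ˡ j) 0) (sym (VP.lookup-replicate j 0)))

  act-flipʳ : ∀ y → act σ (act (Perm.flip σ) y) ≡ y
  act-flipʳ y = lookup-≗⇒≡ λ j →
    trans (lookup-act σ (act (Perm.flip σ) y) j)
          (trans (lookup-act (Perm.flip σ) y (σ ⟨$⟩ˡ j)) (cong (lookup y) (inverseʳ σ)))

act-flipˡ : ∀ {d} (σ : Permutation′ d) x → act (Perm.flip σ) (act σ x) ≡ x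
act-flipˡ σ = act-flipʳ (Perm.flip σ)

act-injective : ∀ {d} (σ : Permutation′ d) → Injective _≡_ _≡_ (act σ)
act-injective σ {x} {y} e = trans (sym (act-flipˡ σ x)) (trans (cong (act (Perm.flip σ)) e) (act-flipˡ σ y))

act-id : ∀ {d} (x : Pt d) → act Perm.id x ≡ x
act-id = VP.tabulate∘lookup

module _ {A : Set} {P Q : Pred A 0ℓ} (P? : Decidable P) (Q? : Decidable Q) where

  count-mono : ∀ {n} {xs : Vec A n} → All (λ x → Q x → P x) xs → count Q? xs ≤ count P? xs
  count-mono {xs = []}     []             = z≤n
  count-mono {xs = x ∷ xs} (Qx⇒Px ∷ Q⇒P) with P? x | Q? x
  ... | yes _ | yes _ = s≤s (count-mono Q⇒P)
  ... | yes _ | no _  = ℕP.m≤n⇒m≤1+n (count-mono Q⇒P)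
  ... | no ¬p | yes q = contradiction (Qx⇒Px q) ¬p
  ... | no _  | no _  = count-mono Q⇒P

  count-< : ∀ {n} {xs : Vec A n} → All (λ x → Q x → P x) xs → Any (λ x → P x × ¬ Q x) xs →
            count Q? xs < count P? xs
  count-< {xs = x ∷ xs} (_ ∷ Q⇒P) (here (p , ¬q)) with P? x | Q? x
  ... | yes _ | yes q = contradiction q ¬q
  ... | yes _ | no _  = s≤s (count-mono Q⇒P)
  ... | no ¬p | _     = contradiction p ¬p
  count-< {xs = x ∷ xs} (Qx⇒Px ∷ Q⇒P) (there any) with P? x | Q? x
  ... | yes _ | yes _ = s≤s (count-< Q⇒P any)
  ... | yes _ | no _  = ℕP.m≤n⇒m≤1+n (count-< Q⇒P any)
  ... | no ¬p | yes q = contradiction (Qx⇒Px q) ¬p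
  ... | no _  | no _  = count-< Q⇒P any

Fin-injective⇒surjective : ∀ {n} (f : Fin n → Fin n) → Injective _≡_ _≡_ f → ∀ k → ∃ λ i → f i ≡ k
Fin-injective⇒surjective {suc n} f f-injective k with FP.any? (λ i → f i FP.≟ k)
... | yes hit = hit
... | no miss = ⊥-elim (FP.<⇒notInjective (ℕP.n<1+n n) punchOut∘f-injective)
  where
    k≢f : ∀ i → k ≢ f i
    k≢f i e = miss (i , sym e)
    punchOut∘f-injective : Injective _≡_ _≡_ (λ i → F.punchOut (k≢f i))
    punchOut∘f-injective e = f-injective (FP.punchOut-injective (k≢f _) (k≢f _) e)

least-counterexample : ∀ {n} {P : Pred (Fin n) 0ℓ} → Decidable P → ¬ (∀ i → P i) →
                       ∃ λ k → ¬ P k × (∀ {i} → i F.< k → P i)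
least-counterexample {n} {P} P? ¬∀P =
  let k , ¬Pk , below = FP.¬∀⟶∃¬-smallest n P P? ¬∀P
  in  k , ¬Pk , λ i<k → subst P (inject-fromℕ< i<k) (below _)
  where
    inject-fromℕ< : ∀ {i k : Fin n} (i<k : i F.< k) → F.inject (F.fromℕ< i<k) ≡ i
    inject-fromℕ< i<k = FP.toℕ-injective (trans (FP.toℕ-inject _) (FP.toℕ-fromℕ< i<k))

fromℕ⊎inject₁ : ∀ {n} (j : Fin (suc n)) → j ≡ fromℕ n ⊎ ∃ λ i → j ≡ inject₁ i
fromℕ⊎inject₁ {zero}  F.zero    = inj₁ refl
fromℕ⊎inject₁ {suc n} F.zero    = inj₂ (F.zero , refl)
fromℕ⊎inject₁ {suc n} (F.suc j) with fromℕ⊎inject₁ j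
... | inj₁ refl       = inj₁ refl
... | inj₂ (i , refl) = inj₂ (F.suc i , refl)

inject₁-fromℕ< : ∀ {m n} (m<n : m < n) → inject₁ (fromℕ< m<n) ≡ fromℕ< (ℕP.m<n⇒m<1+n m<n)
inject₁-fromℕ< m<n =
  FP.toℕ-injective (trans (FP.toℕ-inject₁ _) (trans (FP.toℕ-fromℕ< m<n) (sym (FP.toℕ-fromℕ< _))))

Unique⇒lookup-injective : ∀ {A : Set} {xs : List A} → Unique xs → Injective _≡_ _≡_ (L.lookup xs)
Unique⇒lookup-injective (_ ∷ _)  {F.zero}  {F.zero}  _ = refl
Unique⇒lookup-injective (x∉ ∷ _) {F.zero}  {F.suc j} e = contradiction e (LAll.lookup x∉ (L∈.∈-lookup j))
Unique⇒lookup-injective (x∉ ∷ _) {F.suc i} {F.zero}  e = contradiction (sym e) (LAll.lookup x∉ (L∈.∈-lookup i))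
Unique⇒lookup-injective (_ ∷ u)  {F.suc i} {F.suc j} e = cong F.suc (Unique⇒lookup-injective u e)

≐-swap : ∀ {d} {A B : PSet d} {a b} → ¬ B a → B b → A ≐ (B ∪｛ a ｝) ∖｛ b ｝ → B ≐ (A ∪｛ b ｝) ∖｛ a ｝
≐-swap {A = A} {B} {a} {b} a∉B b∈B (A⊆ , ⊆A) = B⊆ , ⊆B
  where
    B⊆ : ∀ {y} → B y → (A ∪｛ b ｝) y × y ≢ a
    B⊆ {y} By with y ≟ᴾ b
    ... | yes y≡b = inj₂ y≡b , λ { refl → a∉B By }
    ... | no  y≢b = inj₁ (⊆A (inj₁ By , y≢b)) , λ { refl → a∉B By }
    ⊆B : ∀ {y} → (A ∪｛ b ｝) y × y ≢ a → B y
    ⊆B (inj₂ refl , _)   = b∈B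
    ⊆B (inj₁ Ay   , y≢a) with A⊆ Ay
    ... | inj₁ By   , _ = By
    ... | inj₂ y≡a , _ = contradiction y≡a y≢a

record IsDecSubmonoid {d} (S : PSet d) : Set where
  field
    ∈?       : Decidable S
    𝟎∈       : S 𝟎
    ⊕-closed : ∀ {x y} → S x → S y → S (x ⊕ y)

  stable : ∀ {x} → ¬ ¬ S x → S x
  stable = decidable-stable (∈? _)

record DecGNS (g : ℕ) {d} (S : PSet d) : Set where
  field
    isDecSubmonoid : IsDecSubmonoid S
    gap            : Fin g → Pt d
    gap∉           : ∀ i → ¬ S (gap i)
    gap-complete   : ∀ y → ¬ S y → ∃ λ i → gap i ≡ y
    gap-injective  : Injective _≡_ _≡_ gap

  open IsDecSubmonoid isDecSubmonoid public

module _ {g d : ℕ} {S : PSet d} where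

  IsGNS⇒DecGNS : IsGNS g S → DecGNS g S
  IsGNS⇒DecGNS gns = from-gap-list gaps gapsUniq gapsLen gapsCover gapsGap
    where
      open IsGNS gns
      from-gap-list : (xs : List (Pt d)) → Unique xs → length xs ≡ g →
               (∀ x → S x ⊎ x ∈ xs) → (∀ x → x ∈ xs → ¬ S x) → DecGNS g S
      from-gap-list xs xs-unique refl S∪xs xs∉S = record
        { isDecSubmonoid = record { ∈? = ∈? ; 𝟎∈ = zero∈ ; ⊕-closed = closed _ _ }
        ; gap            = L.lookup xs
        ; gap∉           = xs∉S _ ∘ L∈.∈-lookup
        ; gap-complete   = complete
        ; gap-injective  = Unique⇒lookup-injective xs-unique
        }
        where
          ∈? : Decidable S
          ∈? x with S∪xs x
          ... | inj₁ Sx   = yes Sx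
          ... | inj₂ x∈xs = no (xs∉S x x∈xs)
          complete : ∀ y → ¬ S y → ∃ λ i → L.lookup xs i ≡ y
          complete y y∉S with S∪xs y
          ... | inj₁ Sy   = contradiction Sy y∉S
          ... | inj₂ y∈xs = LAny.index y∈xs , sym (LAnyP.lookup-index y∈xs)

  DecGNS-resp : ∀ {T : PSet d} → T ≐ S → DecGNS g S → DecGNS g T
  DecGNS-resp (T⊆S , S⊆T) D = record
    { isDecSubmonoid = record
      { ∈?       = λ x → map′ S⊆T T⊆S (∈? x)
      ; 𝟎∈       = S⊆T 𝟎∈
      ; ⊕-closed = λ Tx Ty → S⊆T (⊕-closed (T⊆S Tx) (T⊆S Ty))
      }
    ; gap            = gap
    ; gap∉           = λ i → gap∉ i ∘ T⊆S
    ; gap-complete   = λ y y∉T → gap-complete y (y∉T ∘ S⊆T)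
    ; gap-injective  = gap-injective
    }
    where open DecGNS D

  module _ (σ : Permutation′ d) where

    actSet-∈⁺ : ∀ {y} → S (act (Perm.flip σ) y) → actSet σ S y
    actSet-∈⁺ {y} Sy′ = act (Perm.flip σ) y , Sy′ , sym (act-flipʳ σ y)

    actSet-∈⁻ : ∀ {y} → actSet σ S y → S (act (Perm.flip σ) y)
    actSet-∈⁻ (x , Sx , refl) = subst S (sym (act-flipˡ σ x)) Sx

    DecGNS-act : DecGNS g S → DecGNS g (actSet σ S)
    DecGNS-act D = record
      { isDecSubmonoid = record
        { ∈?       = λ y → map′ actSet-∈⁺ actSet-∈⁻ (∈? (act (Perm.flip σ) y))
        ; 𝟎∈       = 𝟎 , 𝟎∈ , sym (act-𝟎 σ)
        ; ⊕-closed = λ { (x , Sx , refl) (y , Sy , refl) → x ⊕ y , ⊕-closed Sx Sy , sym (act-⊕ σ x y) }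
        }
      ; gap            = act σ ∘ gap
      ; gap∉           = λ { i (x , Sx , e) → gap∉ i (subst S (sym (act-injective σ e)) Sx) }
      ; gap-complete   = complete
      ; gap-injective  = gap-injective ∘ act-injective σ
      }
      where
        open DecGNS D
        complete : ∀ y → ¬ actSet σ S y → ∃ λ i → act σ (gap i) ≡ y
        complete y y∉ with gap-complete (act (Perm.flip σ) y) (y∉ ∘ actSet-∈⁺)
        ... | i , e = i , trans (cong (act σ) e) (act-flipʳ σ y)

module _ {g d : ℕ} {S : PSet d} (D : DecGNS g S) where
  open DecGNS D

  injective-gap-family-complete : (t : Fin g → Pt d) → Injective _≡_ _≡_ t → (∀ j → ¬ S (t j)) →
                                  ∀ y → ¬ S y → ∃ λ j → t j ≡ y
  injective-gap-family-complete t t-injective t∉S y y∉S =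
    let i , gap-i≡y   = gap-complete y y∉S
        j , index-j≡i = Fin-injective⇒surjective index index-injective i
    in  j , trans (sym (index-spec j)) (trans (cong gap index-j≡i) gap-i≡y)
    where
      index : Fin g → Fin g
      index j = proj₁ (gap-complete (t j) (t∉S j))
      index-spec : ∀ j → gap (index j) ≡ t j
      index-spec j = proj₂ (gap-complete (t j) (t∉S j))
      index-injective : Injective _≡_ _≡_ index
      index-injective e = t-injective (trans (sym (index-spec _)) (trans (cong gap e) (index-spec _)))

  complete-family⇒gaps : (t : Fin g → Pt d) → (∀ y → ¬ S y → ∃ λ j → t j ≡ y) → ∀ j → ¬ S (t j)
  complete-family⇒gaps t t-complete j =
    let i , index-i≡j = Fin-injective⇒surjective index index-injective j
    in  subst (¬_ ∘ S) (trans (sym (index-spec i)) (cong t index-i≡j)) (gap∉ i)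
    where
      index : Fin g → Fin g
      index i = proj₁ (t-complete (gap i) (gap∉ i))
      index-spec : ∀ i → t (index i) ≡ gap i
      index-spec i = proj₂ (t-complete (gap i) (gap∉ i))
      index-injective : Injective _≡_ _≡_ index
      index-injective e = gap-injective (trans (sym (index-spec _)) (trans (cong t e) (index-spec _)))

module DeterministicGraph {d : ℕ} (V : PSet d → Set₁) (E : PSet d → PSet d → Set₁) (r : PSet d)
         (E-deterministic : ∀ {X X′ Y Y′} → X ≐ X′ → E X Y → E X′ Y′ → Y ≐ Y′)
         (E-respʳ : ∀ {X Y Y′} → Y ≐ Y′ → E X Y → E X Y′)
         (r-sink : ∀ {X Y} → E X Y → ¬ X ≐ r) where
  open Graph V E
  open Path

  vtx-cong : ∀ {S T} (p : Path S T) {i j} → i ≡ j → vtx p i ≐ vtx p j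
  vtx-cong p refl = ≐-refl

  trivial-path : ∀ {S} → V S → S ≐ r → Path S r
  trivial-path {S} VS S≐r = record
    { len = 0 ; vtx = λ _ → S ; isVtx = λ _ → VS ; start = ≐-refl ; end = S≐r
    ; edges = λ () ; distinct = λ { F.zero F.zero _ → refl } }

  cons-path : ∀ {S T} → V S → E S T → Path T r → Path S r
  cons-path {S} {T} VS S→T p = record
    { len = suc (len p) ; vtx = vtx′ ; isVtx = isVtx′ ; start = ≐-refl ; end = end p
    ; edges = edges′ ; distinct = distinct′ }
    where
      vtx′ : Fin (suc (suc (len p))) → PSet d
      vtx′ F.zero    = S
      vtx′ (F.suc i) = vtx p i
      isVtx′ : ∀ i → V (vtx′ i)
      isVtx′ F.zero    = VS
      isVtx′ (F.suc i) = isVtx p i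
      edges′ : ∀ i → E (vtx′ (inject₁ i)) (vtx′ (F.suc i))
      edges′ F.zero    = E-respʳ (≐-sym (start p)) S→T
      edges′ (F.suc i) = edges p i
      -- By determinism the vertex after S would be T = vtx p 0 again, and r has no out-edge.
      S∉p : ∀ j → ¬ S ≐ vtx p j
      S∉p j S≐pⱼ with fromℕ⊎inject₁ j
      ... | inj₁ refl       = r-sink S→T (≐-trans S≐pⱼ (end p))
      ... | inj₂ (i , refl) = FP.0≢1+n (sym (distinct p (F.suc i) F.zero
                                (≐-trans (≐-sym (E-deterministic S≐pⱼ S→T (edges p i))) (≐-sym (start p)))))
      distinct′ : ∀ i j → vtx′ i ≐ vtx′ j → i ≡ j
      distinct′ F.zero    F.zero    _   = refl
      distinct′ F.zero    (F.suc j) S≐  = ⊥-elim (S∉p j S≐)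
      distinct′ (F.suc i) F.zero    ≐S  = ⊥-elim (S∉p i (≐-sym ≐S))
      distinct′ (F.suc i) (F.suc j) eq  = cong F.suc (distinct p i j eq)

  module _ {S} (p q : Path S r) where

    agree : ∀ n (n<p : n < suc (len p)) (n<q : n < suc (len q)) → vtx p (fromℕ< n<p) ≐ vtx q (fromℕ< n<q)
    agree zero    _         _         = ≐-trans (start p) (≐-sym (start q))
    agree (suc n) (s≤s n<p) (s≤s n<q) =
      E-deterministic (≐-trans (vtx-cong p (inject₁-fromℕ< n<p))
                      (≐-trans (agree n (ℕP.m<n⇒m<1+n n<p) (ℕP.m<n⇒m<1+n n<q))
                               (vtx-cong q (sym (inject₁-fromℕ< n<q)))))
                      (edges p (fromℕ< n<p)) (edges q (fromℕ< n<q))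

  not-shorter : ∀ {S} (p q : Path S r) → ¬ len p < len q
  not-shorter p q p<q = r-sink (edges q (fromℕ< p<q))
    (≐-trans (vtx-cong q (inject₁-fromℕ< p<q))
    (≐-trans (≐-sym (agree p q (len p) (ℕP.n<1+n _) (ℕP.m<n⇒m<1+n p<q)))
             (≐-trans (vtx-cong p (sym (FP.fromℕ-def (len p)))) (end p))))

  paths-unique : ∀ {S} (p q : Path S r) → SamePath p q
  paths-unique p q with ℕP.<-cmp (len p) (len q)
  ... | tri< p<q _ _ = ⊥-elim (not-shorter p q p<q)
  ... | tri≈ _ p≡q _ = p≡q , agree p q
  ... | tri> _ _ q<p = ⊥-elim (not-shorter q p q<p)

module RelaxedMonomialOrder {d : ℕ} {_≼_ : Pt d → Pt d → Set} (rmo : Order.IsRelaxedMonomialOrder _≼_) where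

  open Order _≼_ public
  open IsRelaxedMonomialOrder rmo public
  open IsTotalOrder isTotalOrder public
    using (antisym) renaming (refl to ≼-refl; reflexive to ≼-reflexive; trans to ≼-trans)

  ≼-totalOrder : TotalOrder 0ℓ 0ℓ 0ℓ
  ≼-totalOrder = record { isTotalOrder = isTotalOrder }

  ≼-decTotalOrder : DecTotalOrder 0ℓ 0ℓ 0ℓ
  ≼-decTotalOrder = TotalOrderProperties.decTotalOrder ≼-totalOrder _≟ᴾ_

  open DecTotalOrderProperties ≼-decTotalOrder public
    using () renaming (<-irrefl to ≺-irrefl; <-trans to ≺-trans; <⇒≱ to ≺⇒⋡; ≮⇒≥ to ⊀⇒≽)
  open Extrema ≼-totalOrder using (max; argmax-all; xs≤max)

  _≺?_ : ∀ x y → Dec (x ≺ y)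
  _≺?_ = ToStrict.<-decidable _≡_ _≼_ _≟ᴾ_ (DecTotalOrder._≤?_ ≼-decTotalOrder)

  ≼-≺-trans : ∀ {x y z} → x ≼ y → y ≺ z → x ≺ z
  ≼-≺-trans = ToStrict.≤-<-trans _≡_ _≼_ ≼-trans antisym (λ { refl y≼z → y≼z })

  x≼x⊕y : ∀ x y → x ≼ (x ⊕ y)
  x≼x⊕y x y = ⊀⇒≽ (λ x⊕y≺x → ≺-irrefl refl (compat (x ⊕ y) x y x⊕y≺x))

  x≺x⊕y : ∀ x {y} → y ≢ 𝟎 → x ≺ x ⊕ y
  x≺x⊕y x {y} y≢𝟎 = x≼x⊕y x y , y≢𝟎 ∘ x⊕y≡x⇒y≡𝟎 ∘ sym

  y≺x⊕y : ∀ {x} y → x ≢ 𝟎 → y ≺ x ⊕ y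
  y≺x⊕y {x} y x≢𝟎 = subst (y ≺_) (⊕-comm y x) (x≺x⊕y y x≢𝟎)

  IsFrob-unique : ∀ {A B f f′} → A ≐ B → IsFrob A f → IsFrob B f′ → f ≡ f′
  IsFrob-unique (A⊆B , B⊆A) (f∉A , below-f) (f′∉B , below-f′) =
    antisym (below-f′ _ (f∉A ∘ B⊆A)) (below-f _ (f′∉B ∘ A⊆B))

  IsMult-unique : ∀ {A B m m′} → A ≐ B → IsMult A m → IsMult B m′ → m ≡ m′
  IsMult-unique (A⊆B , B⊆A) ((Am , m≢𝟎) , above-m) ((Bm′ , m′≢𝟎) , above-m′) =
    antisym (above-m _ (B⊆A Bm′ , m′≢𝟎)) (above-m′ _ (A⊆B Am , m≢𝟎))

  frobenius-exists : ∀ {A : PSet d} {n} → Decidable A → (h : Fin n → Pt d) →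
                     (∀ z → ¬ A z → ∃ λ i → h i ≡ z) → ∀ {y} → ¬ A y → ∃ (IsFrob A)
  frobenius-exists {A} A? h h-complete {y} y∉A = max y gaps , max∉A , below-max
    where
      gaps : List (Pt d)
      gaps = L.filter (¬? ∘ A?) (L.tabulate h)
      max∉A : ¬ A (max y gaps)
      max∉A = argmax-all id y∉A (LAllP.all-filter (¬? ∘ A?) (L.tabulate h))
      below-max : ∀ z → ¬ A z → z ≼ max y gaps
      below-max z z∉A with h-complete z z∉A
      ... | i , refl = LAll.lookup (xs≤max y gaps) (L∈.∈-filter⁺ (¬? ∘ A?) (L∈.∈-tabulate⁺ i) z∉A)

  ∈-above-frobenius : ∀ {A f y} → Decidable A → IsFrob A f → f ≺ y → A y
  ∈-above-frobenius A? (_ , below-f) f≺y = decidable-stable (A? _) (≺⇒⋡ f≺y ∘ below-f _)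

  DecGNS-frobenius : ∀ {g S} → 1 ≤ g → DecGNS g S → ∃ (IsFrob S)
  DecGNS-frobenius (s≤s _) D = frobenius-exists ∈? gap gap-complete (gap∉ F.zero)
    where open DecGNS D

  first-difference-≼ : ∀ {n} {hs hs′ : Fin n → Pt d} {r c} →
                       (∀ i j → i F.< j → hs i ≺ hs j) → (∀ i j → i F.< j → hs′ i ≺ hs′ j) →
                       (∀ {i} → i F.< r → hs i ≡ hs′ i) → hs c ≡ hs′ r → hs r ≼ hs′ r
  first-difference-≼ {r = r} {c} hs↑ hs′↑ agree hs-c≡hs′-r with FP.<-cmp c r
  ... | tri< c<r _ _ = contradiction (trans (sym (agree c<r)) hs-c≡hs′-r) (proj₂ (hs′↑ _ _ c<r))
  ... | tri≈ _ refl _ = ≼-reflexive hs-c≡hs′-r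
  ... | tri> _ _ r<c = subst (_ ≼_) hs-c≡hs′-r (proj₁ (hs↑ _ _ r<c))

  Step-resp : ∀ {A B f m} → A ≐ B → Step A f m ≐ Step B f m
  Step-resp (A⊆B , B⊆A) = (λ { (inj₁ a , ≢m) → inj₁ (A⊆B a) , ≢m ; (inj₂ e , ≢m) → inj₂ e , ≢m })
                        , (λ { (inj₁ b , ≢m) → inj₁ (B⊆A b) , ≢m ; (inj₂ e , ≢m) → inj₂ e , ≢m })

  module StepReversal {S T : PSet d} {f m′ : Pt d} (S-submonoid : IsDecSubmonoid S)
                      (f-frob : IsFrob S f) (m′-mult : IsMult S m′) (m′≺f : m′ ≺ f)
                      (T≐step : T ≐ Step S f m′) where
    open IsDecSubmonoid S-submonoid
    private
      f∉S : ¬ S f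
      f∉S = proj₁ f-frob
      Sm′ : S m′
      Sm′ = proj₁ (proj₁ m′-mult)
      m′≢𝟎 : m′ ≢ 𝟎
      m′≢𝟎 = proj₂ (proj₁ m′-mult)

    f≢m′ : f ≢ m′
    f≢m′ f≡m′ = f∉S (subst S (sym f≡m′) Sm′)

    S≐unstep : S ≐ (T ∪｛ m′ ｝) ∖｛ f ｝
    S≐unstep = ≐-swap f∉S Sm′ T≐step

    S∖m′⊆T : ∀ {y} → S y → y ≢ m′ → T y
    S∖m′⊆T Sy y≢m′ = proj₂ T≐step (inj₁ Sy , y≢m′)

    m′⊕T⊆S : ∀ {t} → T t → S (m′ ⊕ t)
    m′⊕T⊆S Tt with proj₁ T≐step Tt
    ... | inj₁ St   , _ = ⊕-closed Sm′ St
    ... | inj₂ refl , _ = ∈-above-frobenius ∈? f-frob (y≺x⊕y f m′≢𝟎)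

    m′∈SG : SG T m′
    m′∈SG = ( (λ Tm′ → proj₂ (proj₁ T≐step Tm′) refl)
            , λ t (Tt , t≢𝟎) → S∖m′⊆T (m′⊕T⊆S Tt) (t≢𝟎 ∘ x⊕y≡x⇒y≡𝟎) )
          , S∖m′⊆T (⊕-closed Sm′ Sm′) (m′≢𝟎 ∘ x⊕y≡x⇒y≡𝟎)

    m′≺mult : ∀ {m} → IsMult T m → m′ ≺ m
    m′≺mult ((Tm , m≢𝟎) , _) with proj₁ T≐step Tm
    ... | inj₁ Sm   , m≢m′ = proj₂ m′-mult _ (Sm , m≢𝟎) , m≢m′ ∘ sym
    ... | inj₂ refl , _    = m′≺f

    Tf : T f
    Tf = proj₂ T≐step (inj₂ refl , f≢m′)

    f∈U : U (T ∪｛ m′ ｝) f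
    f∈U = ((inj₁ Tf , f≢𝟎) , indecomposable) , above-frobenius
      where
        f≢𝟎 : f ≢ 𝟎
        f≢𝟎 refl = f∉S 𝟎∈
        indecomposable : ¬ (∃[ y ] ∃[ z ] (S* (T ∪｛ m′ ｝) y × S* (T ∪｛ m′ ｝) z × f ≡ y ⊕ z))
        indecomposable (y , z , (y∈ , y≢𝟎) , (z∈ , z≢𝟎) , refl) =
          f∉S (⊕-closed (proj₂ S≐unstep (y∈ , proj₂ (x≺x⊕y y z≢𝟎)))
                        (proj₂ S≐unstep (z∈ , proj₂ (y≺x⊕y z y≢𝟎))))
        above-frobenius : ∀ f′ → IsFrob (T ∪｛ m′ ｝) f′ → f′ ≺ f
        above-frobenius f′ (f′∉ , _) =
          proj₂ f-frob f′ (f′∉ ∘ proj₁ ∘ proj₁ S≐unstep) , λ { refl → f′∉ (inj₁ Tf) }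

  module SwapReversal {g : ℕ} {T S : PSet d} {m h x : Pt d} (T-gns : DecGNS g T) (m-mult : IsMult T m)
                      (h∉T : ¬ T h) (h≺m : h ≺ m) (x∈U : U (T ∪｛ h ｝) x) (x≢h : x ≢ h)
                      (S≐swap : S ≐ (T ∪｛ h ｝) ∖｛ x ｝) where
    open DecGNS T-gns

    x∈T : T x
    x∈T with proj₁ (proj₁ (proj₁ x∈U))
    ... | inj₁ Tx   = Tx
    ... | inj₂ x≡h = contradiction x≡h x≢h

    T≐step : T ≐ Step S x h
    T≐step = ≐-swap h∉T x∈T S≐swap

    h-mult : IsMult S h
    h-mult = (proj₂ S≐swap (inj₂ refl , x≢h ∘ sym) , λ { refl → h∉T 𝟎∈ }) , above-h
      where
        above-h : ∀ t → S* S t → h ≼ t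
        above-h t (St , t≢𝟎) with proj₁ S≐swap St
        ... | inj₁ Tt   , _ = ≼-trans (proj₁ h≺m) (proj₂ m-mult t (Tt , t≢𝟎))
        ... | inj₂ refl , _ = ≼-refl

    x-frob : IsFrob S x
    x-frob = (λ Sx → proj₂ (proj₁ S≐swap Sx) refl) , below-x
      where
        T∪h? : Decidable (T ∪｛ h ｝)
        T∪h? y = ∈? y ⊎-dec (y ≟ᴾ h)
        gap-of-T∪h : ∀ {y} → ¬ S y → y ≢ x → ¬ (T ∪｛ h ｝) y
        gap-of-T∪h y∉S y≢x y∈ = y∉S (proj₂ S≐swap (y∈ , y≢x))
        below-x : ∀ y → ¬ S y → y ≼ x
        below-x y y∉S with y ≟ᴾ x
        ... | yes refl = ≼-refl
        ... | no  y≢x  =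
          let f′ , f′-frob = frobenius-exists T∪h? gap (λ z z∉ → gap-complete z (z∉ ∘ inj₁))
                                              (gap-of-T∪h y∉S y≢x)
          in  ≼-trans (proj₂ f′-frob y (gap-of-T∪h y∉S y≢x)) (proj₁ (proj₂ x∈U f′ f′-frob))

  module _ (g : ℕ) where

    GapSeq-resp : ∀ {A B hs} → A ≐ B → GapSeq g B hs → GapSeq g A hs
    GapSeq-resp (A⊆B , B⊆A) (increasing , enumerates) =
      increasing , λ x → (proj₁ (enumerates x) ∘ (_∘ B⊆A)) , (λ hit → proj₂ (enumerates x) hit ∘ A⊆B)

    ≼R-respˡ : ∀ {A B X} → A ≐ B → _≼R_ g A X → _≼R_ g B X
    ≼R-respˡ A≐B (inj₁ A≐X)      = inj₁ (≐-trans (≐-sym A≐B) A≐X)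
    ≼R-respˡ A≐B (inj₂ A-smaller) = inj₂ λ hs hs′ G G′ → A-smaller hs hs′ (GapSeq-resp A≐B G) G′

    InR-resp : ∀ {A B} → A ≐ B → InR g A → InR g B
    InR-resp A≐B (S′ , gns , (σ , A≐σS′) , minimal) =
      S′ , gns , (σ , ≐-trans (≐-sym A≐B) A≐σS′) , ≼R-respˡ A≐B ∘ minimal

    InR⇒DecGNS : ∀ {A} → InR g A → DecGNS g A
    InR⇒DecGNS (_ , gns , (σ , A≐σS′) , _) = DecGNS-resp A≐σS′ (DecGNS-act σ (IsGNS⇒DecGNS gns))

module SmallestElements {d : ℕ} {_≼_ : Pt d → Pt d → Set} (rmo : Order.IsRelaxedMonomialOrder _≼_)
                        (g : ℕ) {s : Fin (suc g) → Pt d} (GS : Order.GSmallest _≼_ g s) where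
  open RelaxedMonomialOrder rmo
  open PartialOrderReasoning (TotalOrder.poset ≼-totalOrder)

  sᵍ : Pt d
  sᵍ = s (fromℕ g)

  s-increasing : ∀ {i j} → i F.< j → s i ≺ s j
  s-increasing = proj₁ GS _ _

  s-injective : Injective _≡_ _≡_ s
  s-injective {i} {j} sᵢ≡sⱼ with FP.<-cmp i j
  ... | tri< i<j _ _ = contradiction sᵢ≡sⱼ (proj₂ (s-increasing i<j))
  ... | tri≈ _ i≡j _ = i≡j
  ... | tri> _ _ j<i = contradiction (sym sᵢ≡sⱼ) (proj₂ (s-increasing j<i))

  s-monotone : ∀ {i j} → i F.≤ j → s i ≼ s j
  s-monotone {i} {j} i≤j with FP.<-cmp i j
  ... | tri< i<j _ _ = proj₁ (s-increasing i<j)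
  ... | tri≈ _ refl _ = ≼-refl
  ... | tri> _ _ j<i = contradiction i≤j (ℕP.<⇒≱ j<i)

  s-reflects-≺ : ∀ {i j} → s i ≺ s j → i F.< j
  s-reflects-≺ {i} {j} sᵢ≺sⱼ with FP.<-cmp i j
  ... | tri< i<j _ _ = i<j
  ... | tri≈ _ refl _ = contradiction sᵢ≺sⱼ (≺-irrefl refl)
  ... | tri> _ _ j<i = contradiction (proj₁ (s-increasing j<i)) (≺⇒⋡ sᵢ≺sⱼ)

  s≼sᵍ : ∀ i → s i ≼ sᵍ
  s≼sᵍ i = s-monotone (FP.≤fromℕ i)

  ≼sᵍ⇒∈s : ∀ {y} → y ≼ sᵍ → ∃ λ j → s j ≡ y
  ≼sᵍ⇒∈s {y} y≼sᵍ with FP.any? (λ j → s j ≟ᴾ y)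
  ... | yes hit = hit
  ... | no miss = contradiction y≼sᵍ (≺⇒⋡ (proj₂ GS y λ j y≡sⱼ → miss (j , sym y≡sⱼ)))

  s₀≡𝟎 : s F.zero ≡ 𝟎
  s₀≡𝟎 = let j , sⱼ≡𝟎 = ≼sᵍ⇒∈s (zero-least sᵍ)
         in  antisym (subst (s F.zero ≼_) sⱼ≡𝟎 (s-monotone z≤n)) (zero-least _)

  s-suc≢𝟎 : ∀ i → s (F.suc i) ≢ 𝟎
  s-suc≢𝟎 i sᵢ₊₁≡𝟎 = proj₂ (s-increasing (s≤s z≤n)) (trans s₀≡𝟎 (sym sᵢ₊₁≡𝟎))

  O : PSet d
  O = Oset g s

  O? : Decidable O
  O? y with sᵍ ≺? y | y ≟ᴾ 𝟎
  ... | yes sᵍ≺y | _       = yes (inj₁ sᵍ≺y)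
  ... | no  _    | yes y≡𝟎 = yes (inj₂ y≡𝟎)
  ... | no  sᵍ⊀y | no  y≢𝟎 = no λ { (inj₁ sᵍ≺y) → sᵍ⊀y sᵍ≺y ; (inj₂ y≡𝟎) → y≢𝟎 y≡𝟎 }

  s-suc∉O : ∀ i → ¬ O (s (F.suc i))
  s-suc∉O i (inj₁ sᵍ≺sᵢ₊₁) = ≺⇒⋡ sᵍ≺sᵢ₊₁ (s≼sᵍ _)
  s-suc∉O i (inj₂ sᵢ₊₁≡𝟎)  = s-suc≢𝟎 i sᵢ₊₁≡𝟎

  ∉O⇒s-suc : ∀ {y} → ¬ O y → ∃ λ j → s (F.suc j) ≡ y
  ∉O⇒s-suc y∉O with ≼sᵍ⇒∈s (⊀⇒≽ (y∉O ∘ inj₁))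
  ... | F.zero  , s₀≡y = contradiction (inj₂ (trans (sym s₀≡y) s₀≡𝟎)) y∉O
  ... | F.suc j , s≡y  = j , s≡y

  O-closed : ∀ x y → O x → O y → O (x ⊕ y)
  O-closed x y (inj₂ refl) Oy          = subst O (sym (⊕-identityˡ y)) Oy
  O-closed x y (inj₁ sᵍ≺x) (inj₂ refl) = subst O (sym (⊕-identityʳ x)) (inj₁ sᵍ≺x)
  O-closed x y (inj₁ sᵍ≺x) (inj₁ _)    = inj₁ (compat sᵍ x y sᵍ≺x)

  O-isGNS : IsGNS g O
  O-isGNS = record
    { zero∈     = inj₂ refl
    ; closed    = O-closed
    ; gaps      = L.tabulate (s ∘ F.suc)
    ; gapsUniq  = UniqueP.tabulate⁺ (FP.suc-injective ∘ s-injective)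
    ; gapsLen   = LP.length-tabulate _
    ; gapsCover = cover
    ; gapsGap   = λ x x∈gaps → let i , x≡sᵢ₊₁ = L∈.∈-tabulate⁻ x∈gaps in s-suc∉O i ∘ subst O x≡sᵢ₊₁
    }
    where
      cover : ∀ x → O x ⊎ x ∈ L.tabulate (s ∘ F.suc)
      cover x with O? x
      ... | yes Ox  = inj₁ Ox
      ... | no  x∉O = let j , sⱼ₊₁≡x = ∉O⇒s-suc x∉O in inj₂ (subst (_∈ _) sⱼ₊₁≡x (L∈.∈-tabulate⁺ j))

  module _ {S : PSet d} (D : DecGNS g S) where
    open DecGNS D

    ∌s⇒≐O : (∀ i → ¬ S (s (F.suc i))) → S ≐ O
    ∌s⇒≐O ∌s = S⊆O , O⊆S
      where
        s-suc-complete : ∀ y → ¬ S y → ∃ λ j → s (F.suc j) ≡ y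
        s-suc-complete = injective-gap-family-complete D (s ∘ F.suc) (FP.suc-injective ∘ s-injective) ∌s
        S⊆O : ∀ {y} → S y → O y
        S⊆O {y} Sy = decidable-stable (O? y) λ y∉O →
          let j , sⱼ₊₁≡y = ∉O⇒s-suc y∉O in ∌s j (subst S (sym sⱼ₊₁≡y) Sy)
        O⊆S : ∀ {y} → O y → S y
        O⊆S (inj₂ refl) = 𝟎∈
        O⊆S (inj₁ sᵍ≺y) = stable λ y∉S →
          let j , sⱼ₊₁≡y = s-suc-complete _ y∉S in ≺⇒⋡ sᵍ≺y (subst (_≼ sᵍ) sⱼ₊₁≡y (s≼sᵍ _))

    ≐O⊎least-s∈ : S ≐ O ⊎ ∃ λ k → S (s (F.suc k)) × (∀ {i} → i F.< k → ¬ S (s (F.suc i)))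
    ≐O⊎least-s∈ with FP.all? (λ i → ¬? (∈? (s (F.suc i))))
    ... | yes ∌s = inj₁ (∌s⇒≐O ∌s)
    ... | no ¬∌s = let k , ¬¬Sₖ , below = least-counterexample (λ i → ¬? (∈? (s (F.suc i)))) ¬∌s
                   in  inj₂ (k , stable ¬¬Sₖ , below)

    least-s∈-isMult : ∀ {k} → S (s (F.suc k)) → (∀ {i} → i F.< k → ¬ S (s (F.suc i))) →
                      IsMult S (s (F.suc k))
    least-s∈-isMult {k} Sₖ below = (Sₖ , s-suc≢𝟎 k) , λ t (St , t≢𝟎) → ⊀⇒≽ (t⊀sₖ St t≢𝟎)
      where
        t⊀sₖ : ∀ {t} → S t → t ≢ 𝟎 → ¬ t ≺ s (F.suc k)
        t⊀sₖ St t≢𝟎 t≺sₖ with ≼sᵍ⇒∈s (≼-trans (proj₁ t≺sₖ) (s≼sᵍ _))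
        ... | F.zero  , refl = t≢𝟎 s₀≡𝟎
        ... | F.suc i , refl = below (ℕP.≤-pred (s-reflects-≺ t≺sₖ)) St

    ∋s⇒sᵍ≺frob : ∀ {k f} → S (s (F.suc k)) → IsFrob S f → sᵍ ≺ f
    ∋s⇒sᵍ≺frob {k} {f} Sₖ (f∉S , below-f) with sᵍ ≺? f
    ... | yes sᵍ≺f = sᵍ≺f
    ... | no  sᵍ⊀f = contradiction Sₖ (complete-family⇒gaps D (s ∘ F.suc) s-suc-complete k)
      where
        gap∉O : ∀ {y} → ¬ S y → ¬ O y
        gap∉O y∉S (inj₁ sᵍ≺y) = ≺⇒⋡ sᵍ≺y (≼-trans (below-f _ y∉S) (⊀⇒≽ sᵍ⊀f))
        gap∉O y∉S (inj₂ refl) = y∉S 𝟎∈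
        s-suc-complete : ∀ y → ¬ S y → ∃ λ j → s (F.suc j) ≡ y
        s-suc-complete y = ∉O⇒s-suc ∘ gap∉O

    ≉O⇒mult≺frob : ∀ {m f} → ¬ S ≐ O → IsMult S m → IsFrob S f → m ≺ f
    ≉O⇒mult≺frob {m} {f} S≉O (_ , above-m) Frob with ≐O⊎least-s∈
    ... | inj₁ S≐O = contradiction S≐O S≉O
    ... | inj₂ (k , Sₖ , _) = begin-strict
      m            ≤⟨ above-m _ (Sₖ , s-suc≢𝟎 k) ⟩
      s (F.suc k)  ≤⟨ s≼sᵍ _ ⟩
      sᵍ           <⟨ ∋s⇒sᵍ≺frob Sₖ Frob ⟩
      f            ∎

    ∋s⇒O-gaps-precede : ∀ {k} → S (s (F.suc k)) → ∀ hs hs′ → GapSeq g O hs → GapSeq g S hs′ →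
                        ∃ λ r → (∀ i → i F.< r → hs i ≡ hs′ i) × hs r ≺ hs′ r
    ∋s⇒O-gaps-precede {k} Sₖ hs hs′ (hs↑ , hs-enum) (hs′↑ , hs′-enum) =
      let r , hsᵣ≢hs′ᵣ , agree = least-counterexample (λ i → hs i ≟ᴾ hs′ i) differ
      in  r , (λ _ → agree) , first-difference-≺ agree hsᵣ≢hs′ᵣ
      where
        differ : ¬ (∀ i → hs i ≡ hs′ i)
        differ same = let i , hsᵢ≡sₖ = proj₁ (hs-enum _) (s-suc∉O k)
                      in  proj₂ (hs′-enum _) (i , trans (sym (same i)) hsᵢ≡sₖ) Sₖ
        first-difference-≺ : ∀ {r} → (∀ {i} → i F.< r → hs i ≡ hs′ i) → hs r ≢ hs′ r → hs r ≺ hs′ r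
        first-difference-≺ {r} agree hsᵣ≢hs′ᵣ with hs r ≺? hs′ r
        ... | yes hsᵣ≺hs′ᵣ = hsᵣ≺hs′ᵣ
        ... | no  hsᵣ⊀hs′ᵣ = contradiction (first-difference-≼ hs↑ hs′↑ agree (proj₂ hit)) (≺⇒⋡ hs′ᵣ≺hsᵣ)
          where
            hs′ᵣ≺hsᵣ : hs′ r ≺ hs r
            hs′ᵣ≺hsᵣ = ⊀⇒≽ hsᵣ⊀hs′ᵣ , hsᵣ≢hs′ᵣ ∘ sym
            hs′ᵣ∉O : ¬ O (hs′ r)
            hs′ᵣ∉O (inj₁ sᵍ≺hs′ᵣ) = proj₂ (hs-enum _) (r , refl) (inj₁ (≺-trans sᵍ≺hs′ᵣ hs′ᵣ≺hsᵣ))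
            hs′ᵣ∉O (inj₂ hs′ᵣ≡𝟎)  = proj₂ (hs′-enum _) (r , refl) (subst S (sym hs′ᵣ≡𝟎) 𝟎∈)
            hit : ∃ λ c → hs c ≡ hs′ r
            hit = proj₁ (hs-enum _) hs′ᵣ∉O

    O-≼R : _≼R_ g O S
    O-≼R with ≐O⊎least-s∈
    ... | inj₁ S≐O          = inj₁ (≐-sym S≐O)
    ... | inj₂ (_ , Sₖ , _) = inj₂ (∋s⇒O-gaps-precede Sₖ)

  -- The number of s₁, …, s_g in S: an edge removes m(S), the least of them, and adds F(S) ≻ s_g.
  weight : ∀ {S} → DecGNS g S → ℕ
  weight D = V.count (DecGNS.∈? D) (V.tabulate (s ∘ F.suc))

  step-weight-< : ∀ {S T f k} (DS : DecGNS g S) (DT : DecGNS g T) → T ≐ Step S f (s (F.suc k)) →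
                  sᵍ ≺ f → S (s (F.suc k)) → weight DT < weight DS
  step-weight-< {S} {T} {f} {k} DS DT (T⊆step , _) sᵍ≺f Sₖ =
    count-< (DecGNS.∈? DS) (DecGNS.∈? DT) (VAllP.tabulate⁺ (λ i → T⇒S)) (VAnyP.tabulate⁺ k (Sₖ , Tₖ∉T))
    where
      T⇒S : ∀ {i} → T (s (F.suc i)) → S (s (F.suc i))
      T⇒S Tsᵢ with T⊆step Tsᵢ
      ... | inj₁ Ssᵢ , _ = Ssᵢ
      ... | inj₂ refl , _ = contradiction (s≼sᵍ _) (≺⇒⋡ sᵍ≺f)
      Tₖ∉T : ¬ T (s (F.suc k))
      Tₖ∉T Tsₖ = proj₂ (T⊆step Tsₖ) refl

  O∈R : InR g O
  O∈R = O , O-isGNS , (Perm.id , O≐idO) , λ τ → O-≼R (DecGNS-act τ (IsGNS⇒DecGNS O-isGNS))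
    where
      O≐idO : O ≐ actSet Perm.id O
      O≐idO = (λ {y} Oy → y , Oy , sym (act-id y)) , λ { (x , Ox , refl) → subst O (sym (act-id x)) Ox }

  ≐O⇒gap≺nonzero : ∀ {S : PSet d} {x y} → S ≐ O → ¬ S x → S y → y ≢ 𝟎 → x ≺ y
  ≐O⇒gap≺nonzero {x = x} {y} (S⊆O , O⊆S) x∉S Sy y≢𝟎 with S⊆O Sy
  ... | inj₂ y≡𝟎  = contradiction y≡𝟎 y≢𝟎
  ... | inj₁ sᵍ≺y = ≼-≺-trans (⊀⇒≽ (x∉S ∘ O⊆S ∘ inj₁)) sᵍ≺y

module SemigroupTree {d : ℕ} {_≼_ : Pt d → Pt d → Set} (rmo : Order.IsRelaxedMonomialOrder _≼_)
                     {g : ℕ} {s : Fin (suc g) → Pt d} (GS : Order.GSmallest _≼_ g s)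
                     (g≥1 : 1 ≤ g) (og : Order.OGood _≼_ g) where
  open RelaxedMonomialOrder rmo
  open SmallestElements rmo g GS
  open Graph (InR g) (Edge g O)

  Edge-respʳ : ∀ {X Y Y′} → Y ≐ Y′ → Edge g O X Y → Edge g O X Y′
  Edge-respʳ Y≐Y′ (X∈R , Y∈R , X≉O , f , m , f-frob , m-mult , Y≐step) =
    X∈R , InR-resp g Y≐Y′ Y∈R , X≉O , f , m , f-frob , m-mult , ≐-trans (≐-sym Y≐Y′) Y≐step

  Edge-deterministic : ∀ {X X′ Y Y′} → X ≐ X′ → Edge g O X Y → Edge g O X′ Y′ → Y ≐ Y′
  Edge-deterministic X≐X′ (_ , _ , _ , f , m , f-frob , m-mult , Y≐step)
                          (_ , _ , _ , f′ , m′ , f′-frob , m′-mult , Y′≐step)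
    rewrite IsFrob-unique X≐X′ f-frob f′-frob | IsMult-unique X≐X′ m-mult m′-mult =
    ≐-trans Y≐step (≐-trans (Step-resp X≐X′) (≐-sym Y′≐step))

  O-sink : ∀ {X Y} → Edge g O X Y → ¬ X ≐ O
  O-sink = proj₁ ∘ proj₂ ∘ proj₂

  open DeterministicGraph (InR g) (Edge g O) O Edge-deterministic Edge-respʳ O-sink

  edge-weight-< : ∀ {S T} (DS : DecGNS g S) (DT : DecGNS g T) → Edge g O S T → weight DT < weight DS
  edge-weight-< DS DT (_ , _ , S≉O , f , m , f-frob , m-mult , T≐step) with ≐O⊎least-s∈ DS
  ... | inj₁ S≐O = contradiction S≐O S≉O
  ... | inj₂ (k , Sₖ , below) rewrite IsMult-unique ≐-refl m-mult (least-s∈-isMult DS Sₖ below) =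
    step-weight-< DS DT T≐step (∋s⇒sᵍ≺frob DS Sₖ f-frob) Sₖ

  step-edge : ∀ {S f m} → InR g S → ¬ S ≐ O → IsFrob S f → IsMult S m → Edge g O S (Step S f m)
  step-edge S∈R S≉O f-frob m-mult =
    S∈R , og _ S∈R _ _ f-frob m-mult , S≉O , _ , _ , f-frob , m-mult , ≐-refl

  ≐O⊎edge : ∀ {S} → InR g S → S ≐ O ⊎ ∃ (Edge g O S)
  ≐O⊎edge S∈R with ≐O⊎least-s∈ (InR⇒DecGNS g S∈R)
  ... | inj₁ S≐O              = inj₁ S≐O
  ... | inj₂ (k , Sₖ , below) =
    let _ , f-frob = DecGNS-frobenius g≥1 (InR⇒DecGNS g S∈R)
    in  inj₂ (_ , step-edge S∈R (λ S≐O → s-suc∉O k (proj₁ S≐O Sₖ)) f-frob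
                            (least-s∈-isMult (InR⇒DecGNS g S∈R) Sₖ below))

  path-to-O : ∀ n {S} (S∈R : InR g S) → weight (InR⇒DecGNS g S∈R) < n → Path S O
  path-to-O (suc n) S∈R (s≤s w<n) with ≐O⊎edge S∈R
  ... | inj₁ S≐O                    = trivial-path S∈R S≐O
  ... | inj₂ (T , S→T@(_ , T∈R , _)) =
    cons-path S∈R S→T
      (path-to-O n T∈R (ℕP.<-≤-trans (edge-weight-< (InR⇒DecGNS g S∈R) (InR⇒DecGNS g T∈R) S→T) w<n))

  tree : RootedTree O
  tree = O∈R , λ S S∈R → path-to-O _ S∈R (ℕP.n<1+n _) , paths-unique

  AdmissibleSwap : PSet d → Pt d → PSet d → Set₁
  AdmissibleSwap T m S = ∃[ h ] ∃[ x ] (SG T h × h ≺ m × U (T ∪｛ h ｝) x × x ≢ h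
                         × InR g ((T ∪｛ h ｝) ∖｛ x ｝) × S ≐ ((T ∪｛ h ｝) ∖｛ x ｝))

  edge⇒swap : ∀ {S T m} → IsMult T m → Edge g O S T → AdmissibleSwap T m S
  edge⇒swap {S} m-mult (S∈R , _ , S≉O , f , m′ , f-frob , m′-mult , T≐step) =
    m′ , f , m′∈SG , m′≺mult m-mult , f∈U , f≢m′ , InR-resp g S≐unstep S∈R , S≐unstep
    where
      S-gns : DecGNS g S
      S-gns = InR⇒DecGNS g S∈R
      open StepReversal (DecGNS.isDecSubmonoid S-gns) f-frob m′-mult
                        (≉O⇒mult≺frob S-gns S≉O m′-mult f-frob) T≐step

  swap⇒edge : ∀ {S T m} → InR g T → IsMult T m → AdmissibleSwap T m S → Edge g O S T
  swap⇒edge {S} T∈R m-mult (h , x , ((h∉T , _) , _) , h≺m , x∈U , x≢h , swap∈R , S≐swap) =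
    InR-resp g (≐-sym S≐swap) swap∈R , T∈R , S≉O , x , h , x-frob , h-mult , T≐step
    where
      open SwapReversal (InR⇒DecGNS g T∈R) m-mult h∉T h≺m x∈U x≢h S≐swap
      S≉O : ¬ S ≐ O
      S≉O S≐O = ≺⇒⋡ (≐O⇒gap≺nonzero S≐O (proj₁ x-frob) (proj₁ (proj₁ h-mult)) (proj₂ (proj₁ h-mult)))
                    (≼-trans (proj₁ h≺m) (proj₂ m-mult x (x∈T , proj₂ (proj₁ (proj₁ x∈U)))))

mainTheorem5 : ∀ {g d : ℕ} → 1 ≤ g → 1 ≤ d
  → (_≼_ : Pt d → Pt d → Set)
  → Order.IsRelaxedMonomialOrder _≼_
  → Order.OGood _≼_ g
  → (s : _) → Order.GSmallest _≼_ g s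
  → Graph.RootedTree (Order.InR _≼_ g) (Order.Edge _≼_ g (Order.Oset _≼_ g s)) (Order.Oset _≼_ g s)
    × (∀ T → Order.InR _≼_ g T → ∀ m → Order.IsMult _≼_ T m → ∀ S →
        ((Order.Edge _≼_ g (Order.Oset _≼_ g s) S T →
            ∃[ h ] ∃[ x ] (SG T h × Order._≺_ _≼_ h m × Order.U _≼_ (T ∪｛ h ｝) x × x ≢ h
              × Order.InR _≼_ g ((T ∪｛ h ｝) ∖｛ x ｝) × S ≐ ((T ∪｛ h ｝) ∖｛ x ｝)))
        × ((∃[ h ] ∃[ x ] (SG T h × Order._≺_ _≼_ h m × Order.U _≼_ (T ∪｛ h ｝) x × x ≢ h
              × Order.InR _≼_ g ((T ∪｛ h ｝) ∖｛ x ｝) × S ≐ ((T ∪｛ h ｝) ∖｛ x ｝)))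
            → Order.Edge _≼_ g (Order.Oset _≼_ g s) S T)))
mainTheorem5 g≥1 _ _ rmo og _ GS =
  tree , λ T T∈R m m-mult S → edge⇒swap m-mult , swap⇒edge T∈R m-mult
  where open SemigroupTree rmo GS g≥1 og
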